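{- If $n\geq 20$ is an integer, then $\chi(C_n, \{2,3\})=3$.
   Context: $C_n$ is the cycle with vertex set $\mathbb{Z}_n=\{0,1,\dots,n-1\}$, $i$ adjacent to $i\pm1 \pmod n$; the graph distance is $\mathrm{dist}(i,j)=\min(|i-j|,\,n-|i-j|)$. For a set $D$ of positive integers, the distance graph $G(C_n,D)$ has vertex set $\mathbb{Z}_n$, with distinct $i,j$ adjacent iff $\mathrm{dist}(i,j)\in D$; $\chi(C_n,D)$ is its chromatic number. -}

module Defs where

open import Data.Nat using (ℕ; zero; suc; _∸_; _⊔_; _⊓_)
open import Data.Fin using (Fin; toℕ)
open import Data.List using (List)
open import Data.List.Membership.Propositional using (_∈_)
open import Data.Product using (∃; _×_)
open import Relation.Binary.PropositionalEquality using (_≡_; _≢_)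
open import Relation.Nullary using (¬_)

absDiff : ℕ → ℕ → ℕ
absDiff a b = (a ∸ b) ⊔ (b ∸ a)

cycDist : (n : ℕ) → Fin n → Fin n → ℕ
cycDist n i j = absDiff (toℕ i) (toℕ j) ⊓ (n ∸ absDiff (toℕ i) (toℕ j))

Adj : (n : ℕ) → List ℕ → Fin n → Fin n → Set
Adj n D i j = i ≢ j × cycDist n i j ∈ D

ProperColouring : (n : ℕ) → List ℕ → (k : ℕ) → (Fin n → Fin k) → Set
ProperColouring n D k c = ∀ i j → Adj n D i j → c i ≢ c j

Colourable : (n : ℕ) → List ℕ → ℕ → Set
Colourable n D k = ∃ λ (c : Fin n → Fin k) → ProperColouring n D k c

ChromaticNumber : (n : ℕ) → List ℕ → ℕ → Set
ChromaticNumber n D k = Colourable n D k × (∀ m → m Data.Nat.< k → ¬ Colourable n D m)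

-- A colouring of the line that separates every pair at distance 2 or 3 and repeats its first
-- three letters after n positions induces a proper colouring of G(C_n, {2,3}).  Concatenations
-- of the blocks AABBC and AABBCC are such colourings, and every n ≥ 20 is a sum of 5s and 6s.
-- Conversely 0, 3, 6, 4, 2 is an odd cycle of G(C_n, {2,3}), so two colours never suffice.
module Submission where

open import Defs
open import Data.Nat using (ℕ; _≥_; zero; suc; _+_; _*_; _∸_; _⊓_; _≤_; _<_; s≤s)
open import Data.Nat.Properties
open import Data.List using (List; _∷_; [])
open import Data.List.Relation.Unary.Any using (here; there)
open import Data.List.Membership.Propositional using (_∈_)
open import Data.Fin using (Fin; toℕ; inject≤; #_) renaming (zero to fz; suc to fs)
open import Data.Fin.Properties using (toℕ<n; inject≤-injective)
open import Data.Product using (∃₂; _,_)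
open import Data.Sum using (inj₁; inj₂)
open import Data.Empty using (⊥-elim)
open import Function using (_∘_)
open import Relation.Binary.PropositionalEquality
open import Relation.Nullary using (¬_)

absDiff-comm : ∀ x y → absDiff x y ≡ absDiff y x
absDiff-comm x y = ⊔-comm (x ∸ y) (y ∸ x)

absDiff-+ : ∀ x e → absDiff x (x + e) ≡ e
absDiff-+ x e rewrite m≤n⇒m∸n≡0 (m≤m+n x e) | m+n∸m≡n x e = refl

Separates : {k : ℕ} → List ℕ → (ℕ → Fin k) → Set
Separates D f = ∀ {d} → d ∈ D → ∀ i → f i ≢ f (d + i)

Wraps : {k : ℕ} → ℕ → List ℕ → (ℕ → Fin k) → Set
Wraps n D f = ∀ {d} → d ∈ D → ∀ i → i < d → f (n + i) ≡ f i

module _ {k : ℕ} {D : List ℕ} (n : ℕ) (f : ℕ → Fin k) (sep : Separates D f) (wrap : Wraps n D f) where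

  -- If the cyclic distance of x and x + e is d = n ∸ e, then x + e + d = n + x on the line.
  separates-gap : ∀ x e → x + e < n → e ⊓ (n ∸ e) ∈ D → f x ≢ f (x + e)
  separates-gap x e _ m∈D with ⊓-sel e (n ∸ e)
  ... | inj₁ m≡e = subst (λ y → f x ≢ f y) (+-comm e x) (sep (subst (_∈ D) m≡e m∈D) x)
  separates-gap x e x+e<n m∈D | inj₂ m≡n∸e = λ fx≡fx+e →
      sep d∈D (x + e) (sym (trans (cong f shift) (trans (wrap d∈D x x<d) fx≡fx+e)))
    where
    d∈D : n ∸ e ∈ D
    d∈D = subst (_∈ D) m≡n∸e m∈D
    x<d : x < n ∸ e
    x<d = m+n≤o⇒m≤o∸n (suc x) x+e<n
    e≤n : e ≤ n
    e≤n = ≤-trans (m≤n+m e x) (<⇒≤ x+e<n)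
    shift : n ∸ e + (x + e) ≡ n + x
    shift = begin
      n ∸ e + (x + e)   ≡⟨ cong (n ∸ e +_) (+-comm x e) ⟩
      n ∸ e + (e + x)   ≡⟨ sym (+-assoc (n ∸ e) e x) ⟩
      n ∸ e + e + x     ≡⟨ cong (_+ x) (m∸n+n≡m e≤n) ⟩
      n + x             ∎
      where open ≡-Reasoning

  separates-≤ : ∀ {x y} → x ≤ y → y < n → absDiff x y ⊓ (n ∸ absDiff x y) ∈ D → f x ≢ f y
  separates-≤ {x} x≤y y<n m∈D with m≤n⇒∃[o]m+o≡n x≤y
  ... | e , refl = separates-gap x e y<n (subst (λ a → a ⊓ (n ∸ a) ∈ D) (absDiff-+ x e) m∈D)

  separates∧wraps⇒proper : ProperColouring n D k (f ∘ toℕ)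
  separates∧wraps⇒proper i j (_ , dist∈D) with ≤-total (toℕ i) (toℕ j)
  ... | inj₁ i≤j = separates-≤ i≤j (toℕ<n j) dist∈D
  ... | inj₂ j≤i = ≢-sym (separates-≤ j≤i (toℕ<n i)
                     (subst (λ a → a ⊓ (n ∸ a) ∈ D) (absDiff-comm (toℕ i) (toℕ j)) dist∈D))

colourable-mono : ∀ {n D m m′} → m ≤ m′ → Colourable n D m → Colourable n D m′
colourable-mono m≤m′ (c , proper) =
  (λ i → inject≤ (c i) m≤m′) ,
  (λ i j adj eq → proper i j adj (inject≤-injective m≤m′ m≤m′ (c i) (c j) eq))

D₂₃ : List ℕ
D₂₃ = 2 ∷ 3 ∷ []

A B C : Fin 3
A = fz
B = fs fz
C = fs (fs fz)

-- word b is (AABBCC)^b followed by (AABBC)^ω; its first three letters do not depend on b.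
word : ℕ → ℕ → Fin 3
word b 0 = A
word b 1 = A
word b 2 = B
word zero 3 = B
word zero 4 = C
word zero (suc (suc (suc (suc (suc i))))) = word zero i
word (suc b) 3 = B
word (suc b) 4 = C
word (suc b) 5 = C
word (suc b) (suc (suc (suc (suc (suc (suc i)))))) = word b i

word-≢+2 : ∀ b i → word b i ≢ word b (2 + i)
word-≢+2 zero 0 = λ ()
word-≢+2 zero 1 = λ ()
word-≢+2 zero 2 = λ ()
word-≢+2 zero 3 = λ ()
word-≢+2 zero 4 = λ ()
word-≢+2 zero (suc (suc (suc (suc (suc i))))) = word-≢+2 zero i
word-≢+2 (suc b) 0 = λ ()
word-≢+2 (suc b) 1 = λ ()
word-≢+2 (suc b) 2 = λ ()
word-≢+2 (suc b) 3 = λ ()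
word-≢+2 (suc b) 4 = λ ()
word-≢+2 (suc b) 5 = λ ()
word-≢+2 (suc b) (suc (suc (suc (suc (suc (suc i)))))) = word-≢+2 b i

word-≢+3 : ∀ b i → word b i ≢ word b (3 + i)
word-≢+3 zero 0 = λ ()
word-≢+3 zero 1 = λ ()
word-≢+3 zero 2 = λ ()
word-≢+3 zero 3 = λ ()
word-≢+3 zero 4 = λ ()
word-≢+3 zero (suc (suc (suc (suc (suc i))))) = word-≢+3 zero i
word-≢+3 (suc b) 0 = λ ()
word-≢+3 (suc b) 1 = λ ()
word-≢+3 (suc b) 2 = λ ()
word-≢+3 (suc b) 3 = λ ()
word-≢+3 (suc b) 4 = λ ()
word-≢+3 (suc b) 5 = λ ()
word-≢+3 (suc b) (suc (suc (suc (suc (suc (suc i)))))) = word-≢+3 b i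

word-separates : ∀ b → Separates D₂₃ (word b)
word-separates b (here refl)         = word-≢+2 b
word-separates b (there (here refl)) = word-≢+3 b

word-skip-sixes : ∀ b i → word b (b * 6 + i) ≡ word zero i
word-skip-sixes zero    i = refl
word-skip-sixes (suc b) i = word-skip-sixes b i

word-skip-fives : ∀ q i → word zero (q * 5 + i) ≡ word zero i
word-skip-fives zero    i = refl
word-skip-fives (suc q) i = word-skip-fives q i

word-skip-blocks : ∀ b q i → word b (b * 6 + q * 5 + i) ≡ word zero i
word-skip-blocks b q i = begin
  word b (b * 6 + q * 5 + i)     ≡⟨ cong (word b) (+-assoc (b * 6) (q * 5) i) ⟩
  word b (b * 6 + (q * 5 + i))   ≡⟨ word-skip-sixes b (q * 5 + i) ⟩
  word zero (q * 5 + i)          ≡⟨ word-skip-fives q i ⟩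
  word zero i                    ∎
  where open ≡-Reasoning

word-wraps : ∀ b q → Wraps (b * 6 + q * 5) D₂₃ (word b)
word-wraps b q _ 0 _ = word-skip-blocks b q 0
word-wraps b q _ 1 _ = word-skip-blocks b q 1
word-wraps b q _ 2 _ = word-skip-blocks b q 2
word-wraps b q (there (here refl)) (suc (suc (suc i))) (s≤s (s≤s (s≤s ())))
word-wraps b q (there (there ())) _ _

-- 19 = 5·6 − 5 − 6 is the Frobenius number of 5 and 6.
20+k≡6b+5q : ∀ k → ∃₂ λ b q → 20 + k ≡ b * 6 + q * 5
20+k≡6b+5q 0 = 0 , 4 , refl
20+k≡6b+5q 1 = 1 , 3 , refl
20+k≡6b+5q 2 = 2 , 2 , refl
20+k≡6b+5q 3 = 3 , 1 , refl
20+k≡6b+5q 4 = 4 , 0 , refl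
20+k≡6b+5q (suc (suc (suc (suc (suc k))))) with 20+k≡6b+5q k
... | b , q , eq = b , suc q , (begin
  5 + (20 + k)          ≡⟨ cong (5 +_) eq ⟩
  5 + (b * 6 + q * 5)   ≡⟨ +-comm 5 (b * 6 + q * 5) ⟩
  b * 6 + q * 5 + 5     ≡⟨ +-assoc (b * 6) (q * 5) 5 ⟩
  b * 6 + (q * 5 + 5)   ≡⟨ cong (b * 6 +_) (+-comm (q * 5) 5) ⟩
  b * 6 + (5 + q * 5)   ∎)
  where open ≡-Reasoning

3-colourable : ∀ k → Colourable (20 + k) D₂₃ 3
3-colourable k with 20+k≡6b+5q k
... | b , q , eq rewrite eq =
  word b ∘ toℕ , separates∧wraps⇒proper (b * 6 + q * 5) (word b) (word-separates b) (word-wraps b q)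

Fin2-≢-≢⇒≡ : {x y z : Fin 2} → x ≢ y → y ≢ z → x ≡ z
Fin2-≢-≢⇒≡ {fz}    {fz}    x≢y _   = ⊥-elim (x≢y refl)
Fin2-≢-≢⇒≡ {fs fz} {fs fz} x≢y _   = ⊥-elim (x≢y refl)
Fin2-≢-≢⇒≡ {_}     {fz}    {fz}    _ y≢z = ⊥-elim (y≢z refl)
Fin2-≢-≢⇒≡ {_}     {fs fz} {fs fz} _ y≢z = ⊥-elim (y≢z refl)
Fin2-≢-≢⇒≡ {fz}    {fs fz} {fz}    _ _ = refl
Fin2-≢-≢⇒≡ {fs fz} {fz}    {fs fz} _ _ = refl

¬2-colourable : ∀ k → ¬ Colourable (7 + k) D₂₃ 2
¬2-colourable k (c , proper) =
  proper (# 2) (# 0) ((λ ()) , here refl) (trans c2≡c6 (sym c0≡c6))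
  where
  c0≡c6 : c (# 0) ≡ c (# 6)
  c0≡c6 = Fin2-≢-≢⇒≡ (proper (# 0) (# 3) ((λ ()) , there (here refl)))
                     (proper (# 3) (# 6) ((λ ()) , there (here refl)))
  c2≡c6 : c (# 2) ≡ c (# 6)
  c2≡c6 = Fin2-≢-≢⇒≡ (proper (# 2) (# 4) ((λ ()) , here refl))
                     (proper (# 4) (# 6) ((λ ()) , here refl))

chromatic-20+k : ∀ k → ChromaticNumber (20 + k) D₂₃ 3
chromatic-20+k k = 3-colourable k , λ m m<3 → ¬2-colourable (13 + k) ∘ colourable-mono (<⇒≤pred m<3)

lemma3p3p8 : (n : ℕ) → n ≥ 20 → ChromaticNumber n (2 ∷ 3 ∷ []) 3
lemma3p3p8 n 20≤n = subst (λ m → ChromaticNumber m D₂₃ 3) 20+k≡n (chromatic-20+k k)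
  where
  k : ℕ
  k = n ∸ 20
  20+k≡n : 20 + k ≡ n
  20+k≡n = m+[n∸m]≡n 20≤n
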